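{- Let $n,x,k$ be integers with $n-1>x\ge k\ge 1$, $x<2k$ and $F_n(x,k)>0$. Then $$F_n(x,k)=2\binom{n-k-1}{x-k}+(n-k-1)\binom{n-k-2}{x-k}.$$
   Context: For integers $n,x,k\ge 0$, $B_n^{x,k}$ denotes the set of binary strings of length $n$ that contain exactly $x$ zeros and in which the longest block of consecutive zeros has length exactly $k$. $F_n(x,k)=|B_n^{x,k}|$. -}

module Defs where

open import Data.Nat using (ℕ; zero; suc; _+_; _⊔_)
open import Data.Bool using (Bool; true; false)
open import Data.List using (List; []; _∷_; length; filter; map; _++_)
open import Data.Nat using (_≟_)
open import Data.Product using (_×_; _,_)
open import Relation.Nullary.Decidable using (Dec; _×-dec_)

-- Binary strings: lists of bits, 'false' = 0, 'true' = 1.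

strings : ℕ → List (List Bool)
strings zero    = [] ∷ []
strings (suc n) = map (false ∷_) (strings n) ++ map (true ∷_) (strings n)

zeros : List Bool → ℕ
zeros []          = 0
zeros (false ∷ s) = suc (zeros s)
zeros (true ∷ s)  = zeros s

-- Helper: longest block of zeros, given the length `cur` of the
-- current run of zeros ending just before the remaining suffix.
longestFrom : ℕ → List Bool → ℕ
longestFrom cur []          = cur
longestFrom cur (false ∷ s) = longestFrom (suc cur) s
longestFrom cur (true ∷ s)  = cur ⊔ longestFrom 0 s

longestZeroRun : List Bool → ℕ
longestZeroRun = longestFrom 0

F : ℕ → ℕ → ℕ → ℕ
F n x k = length (filter (λ s → (zeros s ≟ x) ×-dec (longestZeroRun s ≟ k)) (strings n))

module Submission where

-- Let k ≥ 1 and let s be a string with m ones and x = k + r zeros, r < k.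
-- Since x < 2k, s has at most one block of zeros of length ≥ k, so "the
-- longest block has length exactly k" is decided by reading s once from
-- left to right while remembering the length c of the current block.
-- Writing d = k − c for the number of zeros that would complete a block
-- of length k, the number of completions with longest block exactly k is
--   comp m (x − d)  +  [d > 0] · m · comp m (x − k),
-- where comp m y counts the ways to distribute y zeros into m gaps: either
-- the current block grows to exactly k, or it is closed early and the
-- k-block follows one of the m ones (the remaining x − k < k zeros are then
-- unconstrained).  At c = 0 (d = k) it gives F = (m + 1) · comp m r,
-- which the absorption identity turns into the stated binomial formula.

open import Defs
open import Data.Nat using (ℕ; _+_; _*_; _∸_; _<_; _≤_)
open import Data.Nat.Combinatorics using (_C_)
open import Relation.Binary.PropositionalEquality using (_≡_)

open import Data.Nat.Base using (zero; suc; _⊔_; z≤n; s≤s; s≤s⁻¹)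
open import Data.Nat.Properties
open import Data.Nat.Combinatorics using (nCn≡1; nCk+nC[k+1]≡[n+1]C[k+1])
open import Data.Nat.Solver using (module +-*-Solver)
open import Data.Bool using (Bool; true; false; _∧_; if_then_else_)
open import Data.Bool.Properties using (∧-identityʳ; ∧-zeroʳ)
open import Data.List using (List; []; _∷_; length; filter; map; _++_)
open import Data.Product using (Σ-syntax; _×_; _,_)
open import Data.Sum using (inj₁; inj₂)
open import Relation.Nullary using (does; yes; no)
open import Relation.Nullary.Decidable using (dec-true; dec-false)
open import Relation.Unary using (Pred; Decidable)
open import Relation.Binary.PropositionalEquality
  using (refl; sym; trans; cong; cong₂; subst; subst₂; module ≡-Reasoning)

open +-*-Solver using (solve; _:+_; _:*_; _:=_; con)

tally : (List Bool → Bool) → List (List Bool) → ℕ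
tally f []       = 0
tally f (s ∷ ss) = if f s then suc (tally f ss) else tally f ss

length-filter≡tally : ∀ {ℓ} {P : Pred (List Bool) ℓ} (P? : Decidable P) ss →
  length (filter P? ss) ≡ tally (λ s → does (P? s)) ss
length-filter≡tally P? []       = refl
length-filter≡tally P? (s ∷ ss) with does (P? s)
... | true  = cong suc (length-filter≡tally P? ss)
... | false = length-filter≡tally P? ss

tally-++ : ∀ f ss ts → tally f (ss ++ ts) ≡ tally f ss + tally f ts
tally-++ f []       ts = refl
tally-++ f (s ∷ ss) ts with f s
... | true  = cong suc (tally-++ f ss ts)
... | false = tally-++ f ss ts

tally-map : ∀ f g ss → tally f (map g ss) ≡ tally (λ s → f (g s)) ss
tally-map f g []       = refl
tally-map f g (s ∷ ss) with f (g s)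
... | true  = cong suc (tally-map f g ss)
... | false = tally-map f g ss

tally-cong : ∀ {f g} → (∀ s → f s ≡ g s) → ∀ ss → tally f ss ≡ tally g ss
tally-cong f≗g []       = refl
tally-cong {g = g} f≗g (s ∷ ss) rewrite f≗g s with g s
... | true  = cong suc (tally-cong f≗g ss)
... | false = tally-cong f≗g ss

count : ℕ → (List Bool → Bool) → ℕ
count n f = tally f (strings n)

count-suc : ∀ n f →
  count (suc n) f ≡ count n (λ s → f (false ∷ s)) + count n (λ s → f (true ∷ s))
count-suc n f = trans (tally-++ f (map (false ∷_) (strings n)) (map (true ∷_) (strings n)))
  (cong₂ _+_ (tally-map f (false ∷_) (strings n)) (tally-map f (true ∷_) (strings n)))

count-cong : ∀ n {f g} → (∀ s → f s ≡ g s) → count n f ≡ count n g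
count-cong n f≗g = tally-cong f≗g (strings n)

count-none : ∀ n f → (∀ s → f s ≡ false) → count n f ≡ 0
count-none n f none = trans (count-cong n none) (tally-none (strings n))
  where
  tally-none : ∀ ss → tally (λ _ → false) ss ≡ 0
  tally-none []       = refl
  tally-none (_ ∷ ss) = tally-none ss

tooFewSymbols : ∀ n y (g : List Bool → Bool) → n < y →
  count n (λ s → does (zeros s ≟ y) ∧ g s) ≡ 0
tooFewSymbols zero    (suc y) g _   = refl
tooFewSymbols (suc n) (suc y) g n<y = trans (count-suc n _)
  (cong₂ _+_ (tooFewSymbols n y (λ s → g (false ∷ s)) (s≤s⁻¹ n<y))
             (tooFewSymbols n (suc y) (λ s → g (true ∷ s)) (m<n⇒m<1+n (s≤s⁻¹ n<y))))

longestFrom-≥ : ∀ c s → c ≤ longestFrom c s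
longestFrom-≥ c []          = ≤-refl
longestFrom-≥ c (false ∷ s) = ≤-trans (n≤1+n c) (longestFrom-≥ (suc c) s)
longestFrom-≥ c (true ∷ s)  = m≤m⊔n c _

longestFrom-≤ : ∀ c s → longestFrom c s ≤ c + zeros s
longestFrom-≤ c []          = ≤-reflexive (sym (+-identityʳ c))
longestFrom-≤ c (false ∷ s) = ≤-trans (longestFrom-≤ (suc c) s) (≤-reflexive (sym (+-suc c (zeros s))))
longestFrom-≤ c (true ∷ s)  = ⊔-lub (m≤m+n c _) (≤-trans (longestFrom-≤ 0 s) (m≤n+m _ c))

-- comp m y: the number of ways to distribute y zeros into m gaps, i.e.
-- the binomial coefficient (m − 1 + y choose y) (and comp 0 y = [y = 0]).
comp : ℕ → ℕ → ℕ
comp zero    zero    = 1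
comp zero    (suc y) = 0
comp (suc m) zero    = 1
comp (suc m) (suc y) = comp m (suc y) + comp (suc m) y

comp-zero : ∀ m → comp m 0 ≡ 1
comp-zero zero    = refl
comp-zero (suc m) = refl

comp-one : ∀ y → comp 1 y ≡ 1
comp-one zero    = refl
comp-one (suc y) = comp-one y

comp-absorb : ∀ m y → m * comp (suc m) y ≡ (m + y) * comp m y
comp-absorb zero    zero    = refl
comp-absorb zero    (suc y) = sym (*-zeroʳ (suc y))
comp-absorb (suc m) zero    = cong (_* 1) (sym (+-identityʳ (suc m)))
comp-absorb (suc m) (suc y) = begin
    suc m * (a + b)
  ≡⟨ solve 3 (λ m a b → (con 1 :+ m) :* (a :+ b) := m :* a :+ a :+ (con 1 :+ m) :* b) refl m a b ⟩
    m * a + a + suc m * b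
  ≡⟨ cong₂ (λ p q → p + a + q) (comp-absorb m (suc y)) (comp-absorb (suc m) y) ⟩
    (m + suc y) * comp m (suc y) + a + (suc m + y) * comp (suc m) y
  ≡⟨ solve 4 (λ m y u v → (m :+ (con 1 :+ y)) :* u :+ (u :+ v) :+ (con 1 :+ m :+ y) :* v
                          := (con 1 :+ m :+ (con 1 :+ y)) :* (u :+ v))
             refl m y (comp m (suc y)) (comp (suc m) y) ⟩
    (suc m + suc y) * a
  ∎
  where
  open ≡-Reasoning
  a = comp (suc m) (suc y)
  b = comp (suc (suc m)) y

comp≡C : ∀ m y → comp (suc m) y ≡ (m + y) C y
comp≡C zero    y       = trans (comp-one y) (sym (nCn≡1 y))
comp≡C (suc m) zero    = refl
comp≡C (suc m) (suc y) = begin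
    comp (suc m) (suc y) + comp (suc (suc m)) y
  ≡⟨ cong₂ _+_ (comp≡C m (suc y)) (comp≡C (suc m) y) ⟩
    (m + suc y) C suc y + (suc m + y) C y
  ≡⟨ cong (λ t → t C suc y + (suc m + y) C y) (+-suc m y) ⟩
    (suc m + y) C suc y + (suc m + y) C y
  ≡⟨ +-comm ((suc m + y) C suc y) _ ⟩
    (suc m + y) C y + (suc m + y) C suc y
  ≡⟨ nCk+nC[k+1]≡[n+1]C[k+1] (suc m + y) y ⟩
    suc (suc m + y) C suc y
  ≡⟨ cong (λ t → suc t C suc y) (sym (+-suc m y)) ⟩
    (suc m + suc y) C suc y
  ∎
  where open ≡-Reasoning

-- (m + 3) · comp (m + 2) r in the binomial form of the theorem: one copy of
-- comp (m + 2) r for each end of the string, the others by absorption.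
binomialForm : ∀ m r →
  suc (suc (suc m)) * comp (suc (suc m)) r ≡ 2 * ((suc m + r) C r) + (suc m + r) * ((m + r) C r)
binomialForm m r = begin
    suc (suc (suc m)) * comp (suc (suc m)) r
  ≡⟨ solve 2 (λ m c → (con 3 :+ m) :* c := con 2 :* c :+ (con 1 :+ m) :* c) refl m (comp (suc (suc m)) r) ⟩
    2 * comp (suc (suc m)) r + suc m * comp (suc (suc m)) r
  ≡⟨ cong (2 * comp (suc (suc m)) r +_) (comp-absorb (suc m) r) ⟩
    2 * comp (suc (suc m)) r + (suc m + r) * comp (suc m) r
  ≡⟨ cong₂ (λ a b → 2 * a + (suc m + r) * b) (comp≡C (suc m) r) (comp≡C m r) ⟩
    2 * ((suc m + r) C r) + (suc m + r) * ((m + r) C r)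
  ∎
  where open ≡-Reasoning

-- Strings with m ones and y zeros: the y zeros fill the m + 1 gaps
-- around the ones.
arrangements : ∀ m y → count (m + y) (λ s → does (zeros s ≟ y)) ≡ comp (suc m) y
arrangements zero    zero    = refl
arrangements zero    (suc y) = trans (count-suc y _)
  (trans (cong₂ _+_ (arrangements zero y)
           (trans (count-cong y (λ s → sym (∧-identityʳ _))) (tooFewSymbols y (suc y) (λ _ → true) ≤-refl)))
         (+-identityʳ _))
arrangements (suc m) zero    = trans (count-suc (m + 0) _)
  (cong₂ _+_ (count-none (m + 0) _ (λ _ → refl)) (trans (arrangements m zero) (comp-zero (suc m))))
arrangements (suc m) (suc y) = trans (count-suc (m + suc y) _)
  (trans (cong₂ _+_ (trans (cong (λ n → count n (λ s → does (zeros s ≟ y))) (+-suc m y))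
                           (arrangements (suc m) y))
                    (arrangements m (suc y)))
         (+-comm (comp (suc (suc m)) y) _))

-- shifted m j x: distributions of x zeros into m gaps after j of them
-- are set aside (0 when j > x).
shifted : ℕ → ℕ → ℕ → ℕ
shifted m zero    x       = comp m x
shifted m (suc j) zero    = 0
shifted m (suc j) (suc x) = shifted m j x

shifted-pascal : ∀ m j x → shifted (suc m) j (suc x) ≡ shifted m j (suc x) + shifted (suc m) j x
shifted-pascal m zero    x             = refl
shifted-pascal m (suc zero)    zero    = sym (trans (+-identityʳ _) (comp-zero m))
shifted-pascal m (suc (suc j)) zero    = refl
shifted-pascal m (suc j)       (suc x) = shifted-pascal m j x

shifted-small : ∀ m j x → x < j → shifted m j x ≡ 0
shifted-small m (suc j) zero    _   = refl
shifted-small m (suc j) (suc x) x<j = shifted-small m j x (s≤s⁻¹ x<j)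

shifted-exact : ∀ m j r → shifted m j (j + r) ≡ comp m r
shifted-exact m zero    r = refl
shifted-exact m (suc j) r = shifted-exact m j r

module ExactBlock (k-1 : ℕ) where

  open ≡-Reasoning

  k : ℕ
  k = suc k-1

  hits : ℕ → ℕ → List Bool → Bool
  hits x c s = does (zeros s ≟ x) ∧ does (longestFrom c s ≟ k)

  F≡count : ∀ n x → F n x k ≡ count n (hits x 0)
  F≡count n x = length-filter≡tally _ (strings n)

  hits-one-short : ∀ {c} x s → c < k → hits x c (true ∷ s) ≡ hits x 0 s
  hits-one-short {c} x s c<k = cong (does (zeros s ≟ x) ∧_) (closes (longestFrom 0 s))
    where
    closes : ∀ L → does ((c ⊔ L) ≟ k) ≡ does (L ≟ k)
    closes L with ≤-total c L
    ... | inj₁ c≤L rewrite m≤n⇒m⊔n≡n c≤L = refl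
    ... | inj₂ L≤c rewrite m≥n⇒m⊔n≡m L≤c =
      trans (dec-false (c ≟ k) (<⇒≢ c<k)) (sym (dec-false (L ≟ k) (<⇒≢ (≤-<-trans L≤c c<k))))

  hits-zero-full : ∀ x s → hits x k (false ∷ s) ≡ false
  hits-zero-full x s rewrite dec-false (longestFrom (suc k) s ≟ k)
                               (λ eq → <⇒≢ (longestFrom-≥ (suc k) s) (sym eq)) = ∧-zeroʳ _

  hits-one-full : ∀ x s → x ≤ k → hits x k (true ∷ s) ≡ does (zeros s ≟ x)
  hits-one-full x s x≤k with zeros s ≤? k
  ... | yes zs≤k = trans (cong (does (zeros s ≟ x) ∧_) (dec-true ((k ⊔ longestFrom 0 s) ≟ k) (m≥n⇒m⊔n≡m (≤-trans (longestFrom-≤ 0 s) zs≤k))))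
                         (∧-identityʳ _)
  ... | no  zs≰k = trans (cong (_∧ does ((k ⊔ longestFrom 0 s) ≟ k)) zs≢x) (sym zs≢x)
    where
    zs≢x : does (zeros s ≟ x) ≡ false
    zs≢x = dec-false (zeros s ≟ x) (λ zs≡x → zs≰k (subst (_≤ k) (sym zs≡x) x≤k))

  step-short : ∀ N x {c} → c < k →
    count (suc N) (hits x c) ≡ count N (λ s → hits x c (false ∷ s)) + count N (hits x 0)
  step-short N x c<k =
    trans (count-suc N _) (cong (count N _ +_) (count-cong N (λ s → hits-one-short x s c<k)))

  -- Closing a complete block of length k: a one must follow, after which any
  -- arrangement of the remaining x ≤ k zeros keeps the longest block at k.
  closeFull : ∀ N x → x ≤ k → count (suc N) (hits x k) ≡ count N (λ s → does (zeros s ≟ x))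
  closeFull N x x≤k = trans (count-suc N _)
    (cong₂ _+_ (count-none N _ (hits-zero-full x)) (count-cong N (λ s → hits-one-full x s x≤k)))

  countFull : ∀ m x → x ≤ k → count (m + x) (hits x k) ≡ comp m x
  countFull zero    zero    _   rewrite dec-true (k ≟ k) refl = refl
  countFull zero    (suc x) x≤k = trans (closeFull x (suc x) x≤k)
    (trans (count-cong x (λ s → sym (∧-identityʳ _))) (tooFewSymbols x (suc x) _ ≤-refl))
  countFull (suc m) x       x≤k = trans (closeFull (m + x) x x≤k) (arrangements m x)

  -- The solution of the scan, for strings with m ones and x zeros read
  -- after a block of k − d zeros: the block either grows to exactly k, or
  -- (if d > 0) it is closed early and the k-block follows one of the m ones.
  predicted : ℕ → ℕ → ℕ → ℕ
  predicted m x zero    = comp m x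
  predicted m x (suc d) = shifted m (suc d) x + m * shifted m k x

  predicted-noOnes : ∀ x d → predicted 0 x d ≡ shifted 0 d x
  predicted-noOnes x zero    = refl
  predicted-noOnes x (suc d) = +-identityʳ _

  -- The bound x < d + k excludes a second
  -- block of length k after the current one has been closed.
  predicted-step : ∀ m x d → x < d + k →
    predicted (suc m) x d + predicted m (suc x) k ≡ predicted (suc m) (suc x) (suc d)
  predicted-step m x zero    x<k rewrite shifted-pascal m k x | shifted-small (suc m) k x x<k =
    solve 3 (λ m c a → c :+ (a :+ m :* a) := c :+ (con 1 :+ m) :* (a :+ con 0))
      refl m (comp (suc m) x) (shifted m k (suc x))
  predicted-step m x (suc d) _   rewrite shifted-pascal m k x =
    solve 4 (λ m b a c → b :+ (con 1 :+ m) :* c :+ (a :+ m :* a) := b :+ (con 1 :+ m) :* (a :+ c))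
      refl m (shifted (suc m) (suc d) x) (shifted m k (suc x)) (shifted (suc m) k x)

  short : ∀ {d c} → suc d + c ≡ k → c < k
  short {d} {c} eq = subst (c <_) eq (s≤s (m≤n+m c d))

  grow : ∀ {d c} → suc d + c ≡ k → d + suc c ≡ k
  grow {d} {c} eq = trans (+-suc d c) eq

  bound : ∀ {d c} → suc d + c ≡ k → suc d ≤ k
  bound {d} {c} eq = subst (suc d ≤_) eq (m≤m+n (suc d) c)

  countRun : ∀ m x d c → d + c ≡ k → x < d + k → count (m + x) (hits x c) ≡ predicted m x d
  countRun m       x       zero    c refl x<k = countFull m x (<⇒≤ x<k)
  countRun zero    zero    (suc d) c eq   _   rewrite dec-false (c ≟ k) (<⇒≢ (short eq)) = refl
  countRun zero    (suc x) (suc d) c eq x<d+k = begin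
      count (suc x) (hits (suc x) c)
    ≡⟨ step-short x (suc x) (short eq) ⟩
      count x (hits x (suc c)) + count x (hits (suc x) 0)
    ≡⟨ cong₂ _+_ (countRun zero x d (suc c) (grow eq) (s≤s⁻¹ x<d+k)) (tooFewSymbols x (suc x) _ ≤-refl) ⟩
      predicted 0 x d + 0
    ≡⟨ trans (+-identityʳ _) (predicted-noOnes x d) ⟩
      shifted 0 d x
    ≡⟨ predicted-noOnes (suc x) (suc d) ⟨
      predicted 0 (suc x) (suc d)
    ∎
  countRun (suc m) zero    (suc d) c eq _     = begin
      count (suc (m + 0)) (hits 0 c)
    ≡⟨ step-short (m + 0) 0 (short eq) ⟩
      count (m + 0) (λ _ → false) + count (m + 0) (hits 0 0)
    ≡⟨ cong₂ _+_ (count-none (m + 0) _ (λ _ → refl)) (countRun m zero k 0 (+-identityʳ k) (s≤s z≤n)) ⟩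
      m * 0
    ≡⟨ trans (*-zeroʳ m) (sym (*-zeroʳ (suc m))) ⟩
      suc m * 0
    ∎
  countRun (suc m) (suc x) (suc d) c eq x<d+k = begin
      count (suc m + suc x) (hits (suc x) c)
    ≡⟨ step-short (m + suc x) (suc x) (short eq) ⟩
      count (m + suc x) (hits x (suc c)) + count (m + suc x) (hits (suc x) 0)
    ≡⟨ cong₂ _+_ (trans (cong (λ n → count n (hits x (suc c))) (+-suc m x))
                        (countRun (suc m) x d (suc c) (grow eq) (s≤s⁻¹ x<d+k)))
                 (countRun m (suc x) k 0 (+-identityʳ k) (≤-trans x<d+k (+-monoˡ-≤ k (bound eq)))) ⟩
      predicted (suc m) x d + predicted m (suc x) k
    ≡⟨ predicted-step m x d (s≤s⁻¹ x<d+k) ⟩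
      predicted (suc m) (suc x) (suc d)
    ∎

  -- F for n = m + x, x = k + r with r < k: the single k-block can be
  -- placed in any of the m + 1 gaps around the ones.
  exactlyOneBlock : ∀ m r → r < k → F (m + (k + r)) (k + r) k ≡ suc m * comp m r
  exactlyOneBlock m r r<k = begin
      F (m + (k + r)) (k + r) k
    ≡⟨ F≡count (m + (k + r)) (k + r) ⟩
      count (m + (k + r)) (hits (k + r) 0)
    ≡⟨ countRun m (k + r) k 0 (+-identityʳ k) (+-monoʳ-< k r<k) ⟩
      shifted m k (k + r) + m * shifted m k (k + r)
    ≡⟨ cong (λ t → t + m * t) (shifted-exact m k r) ⟩
      suc m * comp m r
    ∎

  theorem-shape : ∀ m r → r < k →
    let n = suc (suc m) + (k + r) in
    F n (k + r) k ≡ 2 * ((n ∸ k ∸ 1) C (k + r ∸ k)) + (n ∸ k ∸ 1) * ((n ∸ k ∸ 2) C (k + r ∸ k))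
  theorem-shape m r r<k = begin
      F (suc (suc m) + (k + r)) (k + r) k
    ≡⟨ exactlyOneBlock (suc (suc m)) r r<k ⟩
      suc (suc (suc m)) * comp (suc (suc m)) r
    ≡⟨ binomialForm m r ⟩
      2 * ((suc m + r) C r) + (suc m + r) * ((m + r) C r)
    ≡⟨ cong₂ (λ a b → 2 * ((a ∸ 1) C b) + (a ∸ 1) * ((a ∸ 2) C b)) (sym n∸k) (sym (m+n∸m≡n k r)) ⟩
      2 * ((n ∸ k ∸ 1) C (k + r ∸ k)) + (n ∸ k ∸ 1) * ((n ∸ k ∸ 2) C (k + r ∸ k))
    ∎
    where
    n = suc (suc m) + (k + r)
    n∸k : n ∸ k ≡ suc (suc (m + r))
    n∸k = trans (cong (_∸ k) (solve 3 (λ m k r → con 2 :+ m :+ (k :+ r) := k :+ (con 2 :+ (m :+ r))) refl m k r))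
                (m+n∸m≡n k (suc (suc (m + r))))

decompose : ∀ n x k → x < n ∸ 1 → k ≤ x → x < 2 * k →
  Σ[ m ∈ ℕ ] Σ[ r ∈ ℕ ] n ≡ suc (suc m) + x × x ≡ k + r × r < k
decompose (suc (suc n')) x k (s≤s x≤n') k≤x x<2k =
  n' ∸ x , x ∸ k , cong (λ t → suc (suc t)) (sym (m∸n+n≡m x≤n')) , sym x≡k+r ,
  +-cancelˡ-< k (x ∸ k) k (subst₂ _<_ (sym x≡k+r) (cong (k +_) (+-identityʳ k)) x<2k)
  where
  x≡k+r : k + (x ∸ k) ≡ x
  x≡k+r = m+[n∸m]≡n k≤x

theorem3p1 : (n x k : ℕ) → x < n ∸ 1 → k ≤ x → 1 ≤ k → x < 2 * k → 0 < F n x k →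
    F n x k ≡ 2 * ((n ∸ k ∸ 1) C (x ∸ k)) + (n ∸ k ∸ 1) * ((n ∸ k ∸ 2) C (x ∸ k))
theorem3p1 n x zero      _     _   ()  _   _
theorem3p1 n x (suc k-1) x<n∸1 k≤x _ x<2k _ with decompose n x (suc k-1) x<n∸1 k≤x x<2k
... | m , r , refl , refl , r<k = ExactBlock.theorem-shape k-1 m r r<k
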